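{- Let $p$ be a prime and suppose $A\subseteq\mathbb{F}_p$ satisfies $A-A\doteq\mathcal{R}_p$. Write $n:=|A|$ and fix any quadratic non-residue $\nu\in\mathcal{N}_p$. Then the $n^2$ sums $a'+\nu a''$ with $a',a''\in A$ are pairwise distinct, and the set $D$ of all these sums is a $(p,n^2,n(n+1)/2)$-difference set in $\mathbb{F}_p$.
   Context: $\mathcal{R}_p$ and $\mathcal{N}_p$ are the sets of quadratic residues and quadratic non-residues in $\mathbb{F}_p^\times$. $A-A\doteq\mathcal{R}_p$ means: every element of $\mathcal{R}_p$ has exactly one representation as $a'-a''$ with $a',a''\in A$, and every difference $a'-a''$ with $a',a''\in A$, $a'\neq a''$, lies in $\mathcal{R}_p$. A $(v,k,\lambda)$-difference set is a $k$-element subset of an additive group of order $v$ such that every non-zero group element has exactly $\lambda$ representations as a difference of two elements of the set. -}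

module Defs where

open import Data.Nat using (ℕ; zero; suc; _*_; NonZero)
open import Data.Nat.DivMod using (_%_; m%n<n)
open import Data.Nat.Primality using (Prime; prime⇒nonZero)
open import Data.Fin using (Fin; toℕ; fromℕ<)
open import Data.Fin.Properties using (_≟_)
open import Data.Fin.Subset using (Subset; _∈_)
open import Data.Fin.Subset.Properties using (_∈?_)
open import Data.Vec using (tabulate)
open import Data.List using (List; length; filter; allFin; cartesianProduct)
open import Data.Bool.ListAction using (any)
open import Data.Product using (_×_; _,_; ∃; Σ)
open import Relation.Binary.PropositionalEquality using (_≡_; _≢_)
open import Relation.Nullary using (¬_; does)

module Fp (p : ℕ) (pr : Prime p) where
  private instance
    p≢0 : NonZero p
    p≢0 = prime⇒nonZero pr

  F : Set
  F = Fin p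

  reduce : ℕ → F
  reduce m = fromℕ< (m%n<n m p)

  0F : F
  0F = reduce 0

  infixl 6 _+F_ _-F_
  infixl 7 _*F_

  _+F_ : F → F → F
  x +F y = reduce (toℕ x Data.Nat.+ toℕ y)

  _*F_ : F → F → F
  x *F y = reduce (toℕ x * toℕ y)

  _-F_ : F → F → F
  x -F y = reduce (toℕ x Data.Nat.+ (p Data.Nat.∸ toℕ y))

  IsQR : F → Set
  IsQR x = x ≢ 0F × ∃ λ y → y *F y ≡ x

  IsQNR : F → Set
  IsQNR x = x ≢ 0F × ¬ (∃ λ y → y *F y ≡ x)

  elems : Subset p → List F
  elems S = filter (_∈? S) (allFin p)

  diffCount : Subset p → F → ℕ
  diffCount S x =
    length (filter (λ uv → Data.Product.proj₁ uv -F Data.Product.proj₂ uv ≟ x)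
                   (cartesianProduct (elems S) (elems S)))

  DiffExactlyQR : Subset p → Set
  DiffExactlyQR A =
    (∀ x → IsQR x → diffCount A x ≡ 1) ×
    (∀ a a' → a ∈ A → a' ∈ A → a ≢ a' → IsQR (a -F a'))

  IsDifferenceSet : ℕ → ℕ → ℕ → Subset p → Set
  IsDifferenceSet v k l D =
    v ≡ p × Data.Fin.Subset.∣ D ∣ ≡ k × (∀ x → x ≢ 0F → diffCount D x ≡ l)

  sumSet : Subset p → F → Subset p
  sumSet A ν = tabulate λ x →
    any (λ ab → does (Data.Product.proj₁ ab +F ν *F Data.Product.proj₂ ab ≟ x))
        (cartesianProduct (elems A) (elems A))

-- Let R be the set of non-zero squares and f(r) the number of pairs (u, v) ∈ A² with u − v = r,
-- so f = n·[r = 0] + [r ∈ R] by hypothesis. As 1 ∈ A − A, also −1 ∈ A − A ⊆ R; hence r + ν s = 0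
-- with r, s ∈ R would make ν = −r/s a square, which gives injectivity of (a, b) ↦ a + ν b.
-- Since (a₁ + ν b₁) − (a₂ + ν b₂) = (a₁ − a₂) + ν (b₁ − b₂), the number of representations of
-- x ≠ 0 as a difference of elements of D is
--   Σ_{r,s} f(r) f(s) [r + ν s = x] = n ([x ∈ R] + [x ∈ ν R]) + γ(x),
-- where γ(x) counts the (r, s) ∈ R² with r + ν s = x. The set ν R is exactly the set of
-- non-residues, so the bracket is 1, and γ is invariant under multiplication by residues and
-- by ν, hence constant on F_p^×. Counting all pairs gives |R|² = (p − 1) γ = 2 |R| γ and
-- n² = n + |R|, so every x ≠ 0 is represented n + |R|/2 = n (n + 1)/2 times.

module Submission where

open import Defs
open import Data.Nat using (ℕ; _*_; _+_; _/_)
open import Data.Nat.Primality using (Prime)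
open import Data.Fin.Subset using (Subset; _∈_; ∣_∣)
open import Data.Product using (_×_)
open import Relation.Binary.PropositionalEquality using (_≡_)

open import Algebra.Bundles using (CommutativeRing)
import Algebra.Properties.Group as GroupProperties
import Algebra.Solver.Ring.NaturalCoefficients.Default as NaturalCoefficientsSolver
open import Algebra.Structures using (IsCommutativeRing)
open import Data.Bool using (Bool; true; false)
open import Data.Bool.ListAction using (any)
open import Data.Empty using (⊥-elim)
open import Data.Fin using (Fin; zero; suc; toℕ)
open import Data.Fin.Permutation using (Permutation; permutation)
open import Data.Fin.Properties using (_≟_; any?; suc-injective; toℕ-injective; toℕ-fromℕ<; toℕ<n)
open import Data.Fin.Subset.Properties using (_∈?_)
open import Data.List using (List; []; _∷_; _++_; map; filter; length; cartesianProduct; tabulate; allFin)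
import Data.List.Membership.Propositional as List
open import Data.List.Membership.Propositional.Properties using (∈-filter⁻; ∈-cartesianProduct⁻)
open import Data.List.Properties using (map-++; map-∘)
open import Data.List.Relation.Unary.Any using (here)
open import Data.Nat
  using (zero; suc; NonZero; >-nonZero; nonTrivial⇒n>1; _∸_; _%_; _≤_; _<_; z≤n; s≤s; s≤s⁻¹)
open import Data.Nat.DivMod using (m*n/n≡m; m%n<n; %-distribˡ-+; %-distribˡ-*; m<n⇒m%n≡m; n%n≡0)
open import Data.Nat.Divisibility using (_∣_; m%n≡0⇒n∣m; ∣⇒≤)
open import Data.Nat.ListAction using () renaming (sum to sumˡ)
open import Data.Nat.ListAction.Properties using (sum-++)
open import Data.Nat.Primality using (prime⇒nonZero; prime⇒nonTrivial; euclidsLemma)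
open import Data.Nat.Properties hiding (_≟_; suc-injective)
open import Algebra.Properties.Semiring.Sum +-*-semiring
  using (sum; sum-syntax; sum-cong-≗; ∑-distrib-+; ∑-comm; ∑-permute; *-distribˡ-sum; *-distribʳ-sum)
open import Data.Nat.Tactic.RingSolver using (solve-∀)
open import Data.Product using (_,_; proj₁; proj₂; ∃)
open import Data.Sum using (_⊎_; inj₁; inj₂; [_,_]′)
open import Data.Vec using ([]; _∷_; lookup)
open import Data.Vec.Properties using (lookup∘tabulate)
open import Function using (_∘_; case_of_)
open import Level using (0ℓ)
open import Relation.Binary.PropositionalEquality
  using (_≢_; refl; sym; trans; cong; cong₂; subst; module ≡-Reasoning)
import Relation.Binary.PropositionalEquality.Properties as ≡
open import Relation.Nullary using (Dec; yes; no; does; ¬_)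
open import Relation.Nullary.Decidable using (¬?; _×-dec_; toSum)
open import Relation.Unary using (Decidable)

𝟙 : Bool → ℕ
𝟙 true  = 1
𝟙 false = 0

⟦_⟧ : ∀ {P : Set} → Dec P → ℕ
⟦ d ⟧ = 𝟙 (does d)

module _ {P : Set} where

  ⟦⟧≤1 : (d : Dec P) → ⟦ d ⟧ ≤ 1
  ⟦⟧≤1 (yes _) = s≤s z≤n
  ⟦⟧≤1 (no _)  = z≤n

  ⟦yes⟧ : (d : Dec P) → P → ⟦ d ⟧ ≡ 1
  ⟦yes⟧ (yes _) _  = refl
  ⟦yes⟧ (no ¬p) p  = ⊥-elim (¬p p)

  ⟦no⟧ : (d : Dec P) → ¬ P → ⟦ d ⟧ ≡ 0
  ⟦no⟧ (yes p) ¬p = ⊥-elim (¬p p)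
  ⟦no⟧ (no _)  _  = refl

  ⟦⟧≡1⇒ : (d : Dec P) → ⟦ d ⟧ ≡ 1 → P
  ⟦⟧≡1⇒ (yes p) _ = p

  ⟦⟧>0⇒ : (d : Dec P) → 0 < ⟦ d ⟧ → P
  ⟦⟧>0⇒ (yes p) _ = p

  ⟦⟧-idem : (d : Dec P) → ⟦ d ⟧ * ⟦ d ⟧ ≡ ⟦ d ⟧
  ⟦⟧-idem (yes _) = refl
  ⟦⟧-idem (no _)  = refl

⟦⟧-cong : ∀ {P Q : Set} (d : Dec P) (e : Dec Q) → (P → Q) → (Q → P) → ⟦ d ⟧ ≡ ⟦ e ⟧
⟦⟧-cong (yes _) (yes _) _    _    = refl
⟦⟧-cong (no _)  (no _)  _    _    = refl
⟦⟧-cong (yes p) (no ¬q) p→q  _    = ⊥-elim (¬q (p→q p))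
⟦⟧-cong (no ¬p) (yes q) _    q→p  = ⊥-elim (¬p (q→p q))

⟦⟧-mono : ∀ {P Q : Set} (d : Dec P) (e : Dec Q) → (P → Q) → ⟦ d ⟧ ≤ ⟦ e ⟧
⟦⟧-mono (yes p) e p→q = ≤-reflexive (sym (⟦yes⟧ e (p→q p)))
⟦⟧-mono (no _)  e _   = z≤n

δ : ∀ {n} → Fin n → Fin n → ℕ
δ c x = ⟦ c ≟ x ⟧

δ-refl : ∀ {n} (c : Fin n) → δ c c ≡ 1
δ-refl c = ⟦yes⟧ (c ≟ c) refl

δ-≢ : ∀ {n} {c x : Fin n} → c ≢ x → δ c x ≡ 0
δ-≢ = ⟦no⟧ (_ ≟ _)

δ-sym : ∀ {n} (c x : Fin n) → δ c x ≡ δ x c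
δ-sym c x = ⟦⟧-cong (c ≟ x) (x ≟ c) sym sym

sum-const : ∀ n c → ∑[ i < n ] c ≡ n * c
sum-const zero    c = refl
sum-const (suc n) c = cong (c +_) (sum-const n c)

sum-zero : ∀ {n} {f : Fin n → ℕ} → (∀ x → f x ≡ 0) → sum f ≡ 0
sum-zero {n} f≡0 = trans (sum-cong-≗ f≡0) (trans (sum-const n 0) (*-zeroʳ n))

sum-δ : ∀ {n} (c : Fin n) (f : Fin n → ℕ) → ∑[ x < n ] (δ c x * f x) ≡ f c
sum-δ {suc n} zero f =
  trans (cong₂ _+_ (+-identityʳ (f zero)) (trans (sum-const n 0) (*-zeroʳ n))) (+-identityʳ (f zero))
sum-δ (suc c) f = sum-δ c (f ∘ suc)

sum-δ′ : ∀ {n} (c : Fin n) (f : Fin n → ℕ) → ∑[ x < n ] (δ x c * f x) ≡ f c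
sum-δ′ c f = trans (sum-cong-≗ (λ x → cong (_* f x) (δ-sym x c))) (sum-δ c f)

sum-δ≡1 : ∀ {n} (c : Fin n) → sum (δ c) ≡ 1
sum-δ≡1 c =
  trans (sum-cong-≗ {y = λ x → δ c x * 1} (λ x → sym (*-identityʳ (δ c x)))) (sum-δ c (λ _ → 1))

sum-δ+f+g : ∀ {n} (z : Fin n) (f g : Fin n → ℕ) →
            ∑[ x < n ] (δ z x + (f x + g x)) ≡ 1 + (sum f + sum g)
sum-δ+f+g z f g = trans (∑-distrib-+ (δ z) (λ x → f x + g x)) (cong₂ _+_ (sum-δ≡1 z) (∑-distrib-+ f g))

≤-sum : ∀ {n} (f : Fin n → ℕ) x → f x ≤ sum f
≤-sum f zero    = m≤m+n _ _
≤-sum f (suc x) = ≤-trans (≤-sum (f ∘ suc) x) (m≤n+m _ _)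

sum-mono-≤ : ∀ {n} {f g : Fin n → ℕ} → (∀ x → f x ≤ g x) → sum f ≤ sum g
sum-mono-≤ {zero}  f≤g = z≤n
sum-mono-≤ {suc n} f≤g = +-mono-≤ (f≤g zero) (sum-mono-≤ (f≤g ∘ suc))

sum>0⇒∃ : ∀ {n} (f : Fin n → ℕ) → 0 < sum f → ∃ λ x → 0 < f x
sum>0⇒∃ {suc n} f pos with f zero in eq
... | suc _ = zero , subst (0 <_) (sym eq) (s≤s z≤n)
... | zero  with x , fx>0 ← sum>0⇒∃ (f ∘ suc) pos = suc x , fx>0

sum-≤-≡⇒≡ : ∀ {n} {f g : Fin n → ℕ} →
            (∀ x → f x ≤ g x) → sum f ≡ sum g → ∀ x → f x ≡ g x
sum-≤-≡⇒≡ {suc n} {f} {g} f≤g eq x = go x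
  where
  rest≤ : sum (f ∘ suc) ≤ sum (g ∘ suc)
  rest≤ = sum-mono-≤ (f≤g ∘ suc)
  head≡ : f zero ≡ g zero
  head≡ = ≤-antisym (f≤g zero)
    (+-cancelʳ-≤ _ _ _ (≤-trans (+-monoʳ-≤ (g zero) rest≤) (≤-reflexive (sym eq))))
  go : ∀ x → f x ≡ g x
  go zero    = head≡
  go (suc x) =
    sum-≤-≡⇒≡ (f≤g ∘ suc) (+-cancelˡ-≡ (g zero) _ _ (trans (cong (_+ _) (sym head≡)) eq)) x

sum-≤1 : ∀ {n} (f : Fin n → ℕ) →
         (∀ x → f x ≤ 1) → (∀ x y → f x ≡ 1 → f y ≡ 1 → x ≡ y) → sum f ≤ 1
sum-≤1 {zero}  f f≤1 unique = z≤n
sum-≤1 {suc n} f f≤1 unique with n≤1⇒n≡0∨n≡1 (f≤1 zero)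
... | inj₁ f₀≡0 = subst (λ k → k + sum (f ∘ suc) ≤ 1) (sym f₀≡0)
                    (sum-≤1 (f ∘ suc) (f≤1 ∘ suc) (λ x y fx fy → suc-injective (unique _ _ fx fy)))
... | inj₂ f₀≡1 = ≤-reflexive (cong₂ _+_ f₀≡1 (sum-zero {n} rest≡0))
  where
  rest≡0 : ∀ x → f (suc x) ≡ 0
  rest≡0 x with n≤1⇒n≡0∨n≡1 (f≤1 (suc x))
  ... | inj₁ fx≡0 = fx≡0
  ... | inj₂ fx≡1 with () ← unique _ _ f₀≡1 fx≡1

sum-allBut : ∀ {n} (z : Fin n) (f : Fin n → ℕ) c →
             (∀ x → z ≢ x → f x ≡ c) → sum f + c ≡ f z + n * c
sum-allBut {n} z f c f≡c = begin
  sum f + c                                  ≡⟨ cong (sum f +_) (sum-δ z (λ _ → c)) ⟨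
  sum f + ∑[ x < n ] (δ z x * c)             ≡⟨ ∑-distrib-+ f (λ x → δ z x * c) ⟨
  ∑[ x < n ] (f x + δ z x * c)               ≡⟨ sum-cong-≗ pointwise ⟩
  ∑[ x < n ] (δ z x * f z + c)               ≡⟨ ∑-distrib-+ (λ x → δ z x * f z) (λ _ → c) ⟩
  ∑[ x < n ] (δ z x * f z) + ∑[ x < n ] c    ≡⟨ cong₂ _+_ (sum-δ z (λ _ → f z)) (sum-const n c) ⟩
  f z + n * c                                ∎
  where
  open ≡-Reasoning
  pointwise : ∀ x → f x + δ z x * c ≡ δ z x * f z + c
  pointwise x with z ≟ x
  ... | yes refl = trans (cong (f x +_) (+-identityʳ c)) (cong (_+ c) (sym (+-identityʳ (f x))))
  ... | no z≢x   = trans (+-identityʳ (f x)) (f≡c x z≢x)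

sum-point-mass : ∀ {n} c (z : Fin n) (g f : Fin n → ℕ) →
                 ∑[ u < n ] ((c * δ z u + g u) * f u) ≡ c * f z + ∑[ u < n ] (g u * f u)
sum-point-mass {n} c z g f = begin
  ∑[ u < n ] ((c * δ z u + g u) * f u)
    ≡⟨ sum-cong-≗ (λ u → distrib c (δ z u) (g u) (f u)) ⟩
  ∑[ u < n ] (c * (δ z u * f u) + g u * f u)
    ≡⟨ ∑-distrib-+ (λ u → c * (δ z u * f u)) (λ u → g u * f u) ⟩
  ∑[ u < n ] (c * (δ z u * f u)) + ∑[ u < n ] (g u * f u)
    ≡⟨ cong (_+ _) (*-distribˡ-sum c (λ u → δ z u * f u)) ⟨
  c * ∑[ u < n ] (δ z u * f u) + ∑[ u < n ] (g u * f u)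
    ≡⟨ cong (λ t → c * t + _) (sum-δ z f) ⟩
  c * f z + ∑[ u < n ] (g u * f u)
    ∎
  where
  open ≡-Reasoning
  distrib : ∀ c d g f → (c * d + g) * f ≡ c * (d * f) + g * f
  distrib = solve-∀

pairSum : ∀ {n} → (Fin n → ℕ) → (Fin n → Fin n → ℕ) → ℕ
pairSum {n} w H = ∑[ u < n ] (w u * ∑[ v < n ] (w v * H u v))

module _ {n} (w : Fin n → ℕ) where

  pairSum-cong : ∀ {H K : Fin n → Fin n → ℕ} → (∀ u v → H u v ≡ K u v) → pairSum w H ≡ pairSum w K
  pairSum-cong H≡K =
    sum-cong-≗ (λ u → cong (w u *_) (sum-cong-≗ (λ v → cong (w v *_) (H≡K u v))))

  sum-pairSum : ∀ (H : Fin n → Fin n → Fin n → ℕ) →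
                ∑[ x < n ] pairSum w (λ u v → H u v x) ≡ pairSum w (λ u v → ∑[ x < n ] H u v x)
  sum-pairSum H = begin
    ∑[ x < n ] ∑[ u < n ] (w u * ∑[ v < n ] (w v * H u v x))
      ≡⟨ ∑-comm (λ x u → w u * ∑[ v < n ] (w v * H u v x)) ⟩
    ∑[ u < n ] ∑[ x < n ] (w u * ∑[ v < n ] (w v * H u v x))
      ≡⟨ sum-cong-≗ (λ u → *-distribˡ-sum (w u) (λ x → ∑[ v < n ] (w v * H u v x))) ⟨
    ∑[ u < n ] (w u * ∑[ x < n ] ∑[ v < n ] (w v * H u v x))
      ≡⟨ sum-cong-≗ (λ u → cong (w u *_) (∑-comm (λ x v → w v * H u v x))) ⟩
    ∑[ u < n ] (w u * ∑[ v < n ] ∑[ x < n ] (w v * H u v x))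
      ≡⟨ sum-cong-≗ (λ u → cong (w u *_) (sum-cong-≗ (λ v → *-distribˡ-sum (w v) (H u v)))) ⟨
    pairSum w (λ u v → ∑[ x < n ] H u v x)
      ∎
    where open ≡-Reasoning

  pairSum-*ʳ : ∀ (H : Fin n → Fin n → ℕ) c → pairSum w H * c ≡ pairSum w (λ u v → H u v * c)
  pairSum-*ʳ H c = begin
    pairSum w H * c
      ≡⟨ *-distribʳ-sum c (λ u → w u * ∑[ v < n ] (w v * H u v)) ⟩
    ∑[ u < n ] (w u * ∑[ v < n ] (w v * H u v) * c)
      ≡⟨ sum-cong-≗ (λ u → *-assoc (w u) _ c) ⟩
    ∑[ u < n ] (w u * (∑[ v < n ] (w v * H u v) * c))
      ≡⟨ sum-cong-≗ (λ u → cong (w u *_) (*-distribʳ-sum c (λ v → w v * H u v))) ⟩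
    ∑[ u < n ] (w u * ∑[ v < n ] (w v * H u v * c))
      ≡⟨ sum-cong-≗ (λ u → cong (w u *_) (sum-cong-≗ (λ v → *-assoc (w v) (H u v) c))) ⟩
    pairSum w (λ u v → H u v * c)
      ∎
    where open ≡-Reasoning

  pairSum-swap : ∀ (H : Fin n → Fin n → ℕ) → pairSum w H ≡ pairSum w (λ u v → H v u)
  pairSum-swap H = begin
    ∑[ u < n ] (w u * ∑[ v < n ] (w v * H u v))
      ≡⟨ sum-cong-≗ (λ u → *-distribˡ-sum (w u) (λ v → w v * H u v)) ⟩
    ∑[ u < n ] ∑[ v < n ] (w u * (w v * H u v))
      ≡⟨ ∑-comm (λ u v → w u * (w v * H u v)) ⟩
    ∑[ v < n ] ∑[ u < n ] (w u * (w v * H u v))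
      ≡⟨ sum-cong-≗ (λ v → sum-cong-≗ (λ u → x*[y*z]≡y*[x*z] (w u) (w v) (H u v))) ⟩
    ∑[ v < n ] ∑[ u < n ] (w v * (w u * H u v))
      ≡⟨ sum-cong-≗ (λ v → *-distribˡ-sum (w v) (λ u → w u * H u v)) ⟨
    pairSum w (λ u v → H v u)
      ∎
    where
    open ≡-Reasoning
    x*[y*z]≡y*[x*z] : ∀ x y z → x * (y * z) ≡ y * (x * z)
    x*[y*z]≡y*[x*z] = solve-∀

  pairSum-interchange : ∀ (T : Fin n → Fin n → Fin n → Fin n → ℕ) →
    pairSum w (λ a₁ b₁ → pairSum w (λ a₂ b₂ → T a₁ b₁ a₂ b₂)) ≡
    pairSum w (λ a₁ a₂ → pairSum w (λ b₁ b₂ → T a₁ b₁ a₂ b₂))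
  pairSum-interchange T =
    sum-cong-≗ (λ a₁ → cong (w a₁ *_) (pairSum-swap (λ b₁ a₂ → ∑[ b₂ < n ] (w b₂ * T a₁ b₁ a₂ b₂))))

  sum-pairSum-δ : ∀ (φ : Fin n → Fin n → Fin n) →
                  ∑[ x < n ] pairSum w (λ u v → δ (φ u v) x) ≡ sum w * sum w
  sum-pairSum-δ φ = begin
    ∑[ x < n ] pairSum w (λ u v → δ (φ u v) x)
      ≡⟨ sum-pairSum (λ u v → δ (φ u v)) ⟩
    pairSum w (λ u v → sum (δ (φ u v)))
      ≡⟨ pairSum-cong (λ u v → sum-δ≡1 (φ u v)) ⟩
    ∑[ u < n ] (w u * ∑[ v < n ] (w v * 1))
      ≡⟨ sum-cong-≗ (λ u → cong (w u *_) (sum-cong-≗ (λ v → *-identityʳ (w v)))) ⟩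
    ∑[ u < n ] (w u * sum w)
      ≡⟨ *-distribʳ-sum (sum w) w ⟨
    sum w * sum w
      ∎
    where open ≡-Reasoning

  sum-fibres : ∀ (φ : Fin n → Fin n → Fin n) (G : Fin n → ℕ) →
               ∑[ x < n ] (pairSum w (λ u v → δ (φ u v) x) * G x) ≡ pairSum w (λ u v → G (φ u v))
  sum-fibres φ G = begin
    ∑[ x < n ] (pairSum w (λ u v → δ (φ u v) x) * G x)    ≡⟨ sum-cong-≗ (λ x → pairSum-*ʳ _ (G x)) ⟩
    ∑[ x < n ] pairSum w (λ u v → δ (φ u v) x * G x)      ≡⟨ sum-pairSum (λ u v x → δ (φ u v) x * G x) ⟩
    pairSum w (λ u v → ∑[ x < n ] (δ (φ u v) x * G x))    ≡⟨ pairSum-cong (λ u v → sum-δ (φ u v) G) ⟩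
    pairSum w (λ u v → G (φ u v))                         ∎
    where open ≡-Reasoning

  pairSum-zero : (∀ u → w u ≤ 1) → ∀ (H : Fin n → Fin n → ℕ) →
                 (∀ u v → w u ≡ 1 → w v ≡ 1 → H u v ≡ 0) → pairSum w H ≡ 0
  pairSum-zero w≤1 H H≡0 = sum-zero {n} (λ u → outer u (n≤1⇒n≡0∨n≡1 (w≤1 u)))
    where
    inner : ∀ u → w u ≡ 1 → ∀ v → w v * H u v ≡ 0
    inner u wu≡1 v with n≤1⇒n≡0∨n≡1 (w≤1 v)
    ... | inj₁ wv≡0 = cong (_* H u v) wv≡0
    ... | inj₂ wv≡1 = trans (cong (_* H u v) wv≡1) (trans (*-identityˡ _) (H≡0 u v wu≡1 wv≡1))
    outer : ∀ u → w u ≡ 0 ⊎ w u ≡ 1 → w u * ∑[ v < n ] (w v * H u v) ≡ 0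
    outer u (inj₁ wu≡0) = cong (_* ∑[ v < n ] (w v * H u v)) wu≡0
    outer u (inj₂ wu≡1) = trans (cong (_* ∑[ v < n ] (w v * H u v)) wu≡1)
                                (trans (*-identityˡ _) (sum-zero {n} (inner u wu≡1)))

  InSupport : (Fin n → Fin n → ℕ) → Fin n → Fin n → Set
  InSupport H u v = w u ≡ 1 × w v ≡ 1 × H u v ≡ 1

  pairSum-≤1 : (∀ u → w u ≤ 1) → ∀ (H : Fin n → Fin n → ℕ) → (∀ u v → H u v ≤ 1) →
               (∀ {u v u′ v′} → InSupport H u v → InSupport H u′ v′ → u ≡ u′ × v ≡ v′) →
               pairSum w H ≤ 1
  pairSum-≤1 w≤1 H H≤1 unique = sum-≤1 outer outer≤1
    (λ u u′ o≡1 o′≡1 → proj₁ (unique (proj₂ (witness u o≡1)) (proj₂ (witness u′ o′≡1))))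
    where
    inner : Fin n → Fin n → ℕ
    inner u v = w v * H u v
    outer : Fin n → ℕ
    outer u = w u * sum (inner u)
    inner≤1 : ∀ u v → inner u v ≤ 1
    inner≤1 u v = *-mono-≤ (w≤1 v) (H≤1 u v)
    inner≡1 : ∀ {u v} → inner u v ≡ 1 → w v ≡ 1 × H u v ≡ 1
    inner≡1 {u} {v} eq = m*n≡1⇒m≡1 (w v) (H u v) eq , m*n≡1⇒n≡1 (w v) (H u v) eq
    witness : ∀ u → outer u ≡ 1 → ∃ (InSupport H u)
    witness u o≡1 =
      let v , inner>0 = sum>0⇒∃ (inner u) (≤-reflexive (sym (m*n≡1⇒n≡1 (w u) _ o≡1)))
      in  v , m*n≡1⇒m≡1 (w u) _ o≡1 , inner≡1 (≤-antisym (inner≤1 u v) inner>0)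
    outer≤1 : ∀ u → outer u ≤ 1
    outer≤1 u with n≤1⇒n≡0∨n≡1 (w≤1 u)
    ... | inj₁ wu≡0 = ≤-trans (≤-reflexive (cong (_* sum (inner u)) wu≡0)) z≤n
    ... | inj₂ wu≡1 = ≤-trans (≤-reflexive (trans (cong (_* sum (inner u)) wu≡1) (*-identityˡ _)))
      (sum-≤1 (inner u) (inner≤1 u)
        (λ v v′ i≡1 i′≡1 → proj₂ (unique (wu≡1 , inner≡1 i≡1) (wu≡1 , inner≡1 i′≡1))))

pairSum-congʷ : ∀ {n} {w w′ : Fin n → ℕ} (H : Fin n → Fin n → ℕ) →
                (∀ u → w u ≡ w′ u) → pairSum w H ≡ pairSum w′ H
pairSum-congʷ H w≡w′ =
  sum-cong-≗ (λ u → cong₂ _*_ (w≡w′ u) (sum-cong-≗ (λ v → cong (_* H u v) (w≡w′ v))))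

pairSum-point-mass : ∀ {n} c (z : Fin n) (g : Fin n → ℕ) (H : Fin n → Fin n → ℕ) →
  pairSum (λ u → c * δ z u + g u) H ≡
  c * (c * H z z + ∑[ v < n ] (g v * H z v)) + ∑[ u < n ] (g u * (c * H u z + ∑[ v < n ] (g v * H u v)))
pairSum-point-mass {n} c z g H =
  trans (sum-cong-≗ (λ u → cong ((c * δ z u + g u) *_) (sum-point-mass c z g (H u))))
        (sum-point-mass c z g (λ u → c * H u z + ∑[ v < n ] (g v * H u v)))

module _ {A : Set} where

  length≡1⇒∃∈ : ∀ {xs : List A} → length xs ≡ 1 → ∃ λ x → x List.∈ xs
  length≡1⇒∃∈ {x ∷ _} _ = x , here refl

  length-filter≡sum : {P : A → Set} (P? : Decidable P) (xs : List A) →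
                      length (filter P? xs) ≡ sumˡ (map (⟦_⟧ ∘ P?) xs)
  length-filter≡sum P? []       = refl
  length-filter≡sum P? (x ∷ xs) with P? x
  ... | yes _ = cong suc (length-filter≡sum P? xs)
  ... | no _  = length-filter≡sum P? xs

  sum-map-filter : {P : A → Set} (P? : Decidable P) (h : A → ℕ) (xs : List A) →
                   sumˡ (map h (filter P? xs)) ≡ sumˡ (map (λ x → ⟦ P? x ⟧ * h x) xs)
  sum-map-filter P? h []       = refl
  sum-map-filter P? h (x ∷ xs) with P? x
  ... | yes _ = cong₂ _+_ (sym (+-identityʳ (h x))) (sum-map-filter P? h xs)
  ... | no _  = sum-map-filter P? h xs

  𝟙-any : (f : A → Bool) (xs : List A) → sumˡ (map (𝟙 ∘ f) xs) ≤ 1 →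
          𝟙 (any f xs) ≡ sumˡ (map (𝟙 ∘ f) xs)
  𝟙-any f []       _ = refl
  𝟙-any f (x ∷ xs) ≤1 with f x
  ... | false = 𝟙-any f xs ≤1
  ... | true  = cong suc (sym (n≤0⇒n≡0 (s≤s⁻¹ ≤1)))

  sum-map-cartesianProduct : {B : Set} (h : A × B → ℕ) (xs : List A) (ys : List B) →
    sumˡ (map h (cartesianProduct xs ys)) ≡ sumˡ (map (λ x → sumˡ (map (λ y → h (x , y)) ys)) xs)
  sum-map-cartesianProduct h []       ys = refl
  sum-map-cartesianProduct h (x ∷ xs) ys = begin
    sumˡ (map h (map (x ,_) ys ++ cartesianProduct xs ys))
      ≡⟨ cong sumˡ (map-++ h (map (x ,_) ys) _) ⟩
    sumˡ (map h (map (x ,_) ys) ++ map h (cartesianProduct xs ys))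
      ≡⟨ sum-++ (map h (map (x ,_) ys)) _ ⟩
    sumˡ (map h (map (x ,_) ys)) + sumˡ (map h (cartesianProduct xs ys))
      ≡⟨ cong₂ _+_ (cong sumˡ (sym (map-∘ ys))) (sum-map-cartesianProduct h xs ys) ⟩
    sumˡ (map (λ y → h (x , y)) ys) + sumˡ (map (λ x → sumˡ (map (λ y → h (x , y)) ys)) xs) ∎
    where open ≡-Reasoning

sum-map-tabulate : ∀ {n} {A : Set} (g : Fin n → A) (h : A → ℕ) →
                   sumˡ (map h (tabulate g)) ≡ sum (h ∘ g)
sum-map-tabulate {zero}  g h = refl
sum-map-tabulate {suc n} g h = cong (h (g zero) +_) (sum-map-tabulate (g ∘ suc) h)

module _ {n : ℕ} (S : Subset n) where

  χ : Fin n → ℕ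
  χ x = ⟦ x ∈? S ⟧

  sum-map-members : (h : Fin n → ℕ) →
                    sumˡ (map h (filter (_∈? S) (allFin n))) ≡ ∑[ x < n ] (χ x * h x)
  sum-map-members h =
    trans (sum-map-filter (_∈? S) h (allFin n)) (sum-map-tabulate (λ x → x) (λ x → χ x * h x))

  χ≡𝟙∘lookup : ∀ x → χ x ≡ 𝟙 (lookup S x)
  χ≡𝟙∘lookup x = go S x
    where
    go : ∀ {m} (T : Subset m) x → ⟦ x ∈? T ⟧ ≡ 𝟙 (lookup T x)
    go (true  ∷ T) zero    = refl
    go (false ∷ T) zero    = refl
    go (_     ∷ T) (suc x) = go T x

  ∣∣≡sum-χ : ∣ S ∣ ≡ sum χ
  ∣∣≡sum-χ = go S
    where
    go : ∀ {m} (T : Subset m) → ∣ T ∣ ≡ ∑[ x < m ] ⟦ x ∈? T ⟧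
    go []          = refl
    go (true  ∷ T) = cong suc (go T)
    go (false ∷ T) = go T

module PrimeField (p : ℕ) (pr : Prime p) where
  open Fp p pr

  instance
    p-nonZero : NonZero p
    p-nonZero = prime⇒nonZero pr

  1F : F
  1F = reduce 1

  negF : F → F
  negF y = reduce (p ∸ toℕ y)

  toℕ-reduce : ∀ m → toℕ (reduce m) ≡ m % p
  toℕ-reduce m = toℕ-fromℕ< (m%n<n m p)

  reduce-%-cong : ∀ {m k} → m % p ≡ k % p → reduce m ≡ reduce k
  reduce-%-cong {m} {k} eq = toℕ-injective (trans (toℕ-reduce m) (trans eq (sym (toℕ-reduce k))))

  reduce-toℕ : ∀ x → reduce (toℕ x) ≡ x
  reduce-toℕ x = toℕ-injective (trans (toℕ-reduce (toℕ x)) (m<n⇒m%n≡m (toℕ<n x)))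

  reduce-+ : ∀ m k → reduce m +F reduce k ≡ reduce (m + k)
  reduce-+ m k = reduce-%-cong (trans (cong (_% p) (cong₂ _+_ (toℕ-reduce m) (toℕ-reduce k)))
                                      (sym (%-distribˡ-+ m k p)))

  reduce-* : ∀ m k → reduce m *F reduce k ≡ reduce (m * k)
  reduce-* m k = reduce-%-cong (trans (cong (_% p) (cong₂ _*_ (toℕ-reduce m) (toℕ-reduce k)))
                                      (sym (%-distribˡ-* m k p)))

  1<p : 1 < p
  1<p = nonTrivial⇒n>1 p {{prime⇒nonTrivial pr}}

  0%p≡0 : 0 % p ≡ 0
  0%p≡0 = m<n⇒m%n≡m (<⇒≤ 1<p)

  toℕ-0F : toℕ 0F ≡ 0
  toℕ-0F = trans (toℕ-reduce 0) 0%p≡0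

  toℕ-1F : toℕ 1F ≡ 1
  toℕ-1F = trans (toℕ-reduce 1) (m<n⇒m%n≡m 1<p)

  1F≢0F : 1F ≢ 0F
  1F≢0F 1≡0 with () ← trans (sym toℕ-1F) (trans (cong toℕ 1≡0) toℕ-0F)

  -- reduce : ℕ → F is a surjective homomorphism of semirings, so the ring laws are inherited from ℕ.
  module _ (x y z : F) where
    private
      a b c : ℕ
      a = toℕ x
      b = toℕ y
      c = toℕ z
    open ≡-Reasoning

    +F-assoc : (x +F y) +F z ≡ x +F (y +F z)
    +F-assoc = begin
      (x +F y) +F z                 ≡⟨⟩
      reduce (a + b) +F z           ≡⟨ cong (reduce (a + b) +F_) (reduce-toℕ z) ⟨
      reduce (a + b) +F reduce c    ≡⟨ reduce-+ (a + b) c ⟩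
      reduce (a + b + c)            ≡⟨ cong reduce (+-assoc a b c) ⟩
      reduce (a + (b + c))          ≡⟨ reduce-+ a (b + c) ⟨
      reduce a +F reduce (b + c)    ≡⟨ cong (_+F (y +F z)) (reduce-toℕ x) ⟩
      x +F (y +F z)                 ∎

    *F-assoc : (x *F y) *F z ≡ x *F (y *F z)
    *F-assoc = begin
      (x *F y) *F z                 ≡⟨⟩
      reduce (a * b) *F z           ≡⟨ cong (reduce (a * b) *F_) (reduce-toℕ z) ⟨
      reduce (a * b) *F reduce c    ≡⟨ reduce-* (a * b) c ⟩
      reduce (a * b * c)            ≡⟨ cong reduce (*-assoc a b c) ⟩
      reduce (a * (b * c))          ≡⟨ reduce-* a (b * c) ⟨
      reduce a *F reduce (b * c)    ≡⟨ cong (_*F (y *F z)) (reduce-toℕ x) ⟩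
      x *F (y *F z)                 ∎

    *F-distribˡ-+F : x *F (y +F z) ≡ (x *F y) +F (x *F z)
    *F-distribˡ-+F = begin
      x *F (y +F z)                    ≡⟨⟩
      x *F reduce (b + c)              ≡⟨ cong (_*F reduce (b + c)) (reduce-toℕ x) ⟨
      reduce a *F reduce (b + c)       ≡⟨ reduce-* a (b + c) ⟩
      reduce (a * (b + c))             ≡⟨ cong reduce (*-distribˡ-+ a b c) ⟩
      reduce (a * b + a * c)           ≡⟨ reduce-+ (a * b) (a * c) ⟨
      reduce (a * b) +F reduce (a * c) ≡⟨⟩
      (x *F y) +F (x *F z)             ∎

  +F-comm : ∀ x y → x +F y ≡ y +F x
  +F-comm x y = cong reduce (+-comm (toℕ x) (toℕ y))

  *F-comm : ∀ x y → x *F y ≡ y *F x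
  *F-comm x y = cong reduce (*-comm (toℕ x) (toℕ y))

  +F-identityˡ : ∀ x → 0F +F x ≡ x
  +F-identityˡ x =
    trans (cong (0F +F_) (sym (reduce-toℕ x))) (trans (reduce-+ 0 (toℕ x)) (reduce-toℕ x))

  *F-identityˡ : ∀ x → 1F *F x ≡ x
  *F-identityˡ x = trans (cong (1F *F_) (sym (reduce-toℕ x)))
    (trans (reduce-* 1 (toℕ x)) (trans (cong reduce (*-identityˡ (toℕ x))) (reduce-toℕ x)))

  negF-inverseʳ : ∀ x → x +F negF x ≡ 0F
  negF-inverseʳ x = begin
    x +F negF x                      ≡⟨ cong (_+F negF x) (reduce-toℕ x) ⟨
    reduce a +F reduce (p ∸ a)       ≡⟨ reduce-+ a (p ∸ a) ⟩
    reduce (a + (p ∸ a))             ≡⟨ cong reduce (m+[n∸m]≡n (<⇒≤ (toℕ<n x))) ⟩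
    reduce p                         ≡⟨ reduce-%-cong (trans (n%n≡0 p) (sym 0%p≡0)) ⟩
    0F                               ∎
    where
    open ≡-Reasoning
    a : ℕ
    a = toℕ x

  -F≡+F-negF : ∀ x y → x -F y ≡ x +F negF y
  -F≡+F-negF x y = trans (sym (reduce-+ (toℕ x) (p ∸ toℕ y))) (cong (_+F negF y) (reduce-toℕ x))

  open import Algebra.Consequences.Propositional {A = F}
    using (comm∧idˡ⇒id; comm∧invʳ⇒inv; comm∧distrˡ⇒distrʳ)

  isCommutativeRing : IsCommutativeRing _≡_ _+F_ _*F_ negF 0F 1F
  isCommutativeRing = record
    { isRing = record
      { +-isAbelianGroup = record
        { isGroup = record
          { isMonoid = record
            { isSemigroup = record
              { isMagma = record { isEquivalence = ≡.isEquivalence ; ∙-cong = cong₂ _+F_ }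
              ; assoc   = +F-assoc }
            ; identity = comm∧idˡ⇒id +F-comm +F-identityˡ }
          ; inverse = comm∧invʳ⇒inv +F-comm negF-inverseʳ
          ; ⁻¹-cong = cong negF }
        ; comm = +F-comm }
      ; *-cong     = cong₂ _*F_
      ; *-assoc    = *F-assoc
      ; *-identity = comm∧idˡ⇒id *F-comm *F-identityˡ
      ; distrib    = *F-distribˡ-+F , comm∧distrˡ⇒distrʳ *F-comm *F-distribˡ-+F }
    ; *-comm = *F-comm }

  commutativeRing : CommutativeRing 0ℓ 0ℓ
  commutativeRing = record { isCommutativeRing = isCommutativeRing }

  open CommutativeRing commutativeRing public using ()
    renaming ( +-identityʳ to +F-identityʳ; *-identityʳ to *F-identityʳ; -‿inverseˡ to negF-inverseˡ
             ; distribʳ to *F-distribʳ-+F; zeroˡ to *F-zeroˡ; zeroʳ to *F-zeroʳ)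
  open NaturalCoefficientsSolver (CommutativeRing.commutativeSemiring commutativeRing) public
    using (solve; _:+_; _:*_; _:=_)
  open GroupProperties (CommutativeRing.+-group commutativeRing) public using ()
    renaming ( ∙-cancelʳ to +F-cancelʳ; x∙y⁻¹≈ε⇒x≈y to x+negF-y≡0⇒x≡y
             ; inverseˡ-unique to +F≡0⇒≡negF; inverseʳ-unique to +F≡0⇒≡negFʳ)
  open import Algebra.Properties.Ring (CommutativeRing.ring commutativeRing) public using ()
    renaming (-1*x≈-x to negF1*x≡negF-x)

  -F-self : ∀ x → x -F x ≡ 0F
  -F-self x = trans (-F≡+F-negF x x) (negF-inverseʳ x)

  -F≡0⇒≡ : ∀ {x y} → x -F y ≡ 0F → x ≡ y
  -F≡0⇒≡ {x} {y} eq = x+negF-y≡0⇒x≡y x y (trans (sym (-F≡+F-negF x y)) eq)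

  x-y+y≡x : ∀ x y → (x -F y) +F y ≡ x
  x-y+y≡x x y = begin
    (x -F y) +F y          ≡⟨ cong (_+F y) (-F≡+F-negF x y) ⟩
    (x +F negF y) +F y     ≡⟨ +F-assoc x (negF y) y ⟩
    x +F (negF y +F y)     ≡⟨ cong (x +F_) (negF-inverseˡ y) ⟩
    x +F 0F                ≡⟨ +F-identityʳ x ⟩
    x                      ∎
    where open ≡-Reasoning

  x+y-y≡x : ∀ x y → (x +F y) -F y ≡ x
  x+y-y≡x x y = begin
    (x +F y) -F y             ≡⟨ -F≡+F-negF (x +F y) y ⟩
    (x +F y) +F negF y        ≡⟨ +F-assoc x y (negF y) ⟩
    x +F (y +F negF y)        ≡⟨ cong (x +F_) (negF-inverseʳ y) ⟩
    x +F 0F                   ≡⟨ +F-identityʳ x ⟩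
    x                         ∎
    where open ≡-Reasoning

  p∣toℕ⇒≡0F : ∀ z → p ∣ toℕ z → z ≡ 0F
  p∣toℕ⇒≡0F z p∣z with toℕ z in eq
  ... | zero  = toℕ-injective (trans eq (sym toℕ-0F))
  ... | suc _ = ⊥-elim (<⇒≱ (subst (_< p) eq (toℕ<n z)) (∣⇒≤ p∣z))

  *F-zero-divisor : ∀ {x y} → x *F y ≡ 0F → x ≡ 0F ⊎ y ≡ 0F
  *F-zero-divisor {x} {y} xy≡0 =
    Data.Sum.map (p∣toℕ⇒≡0F x) (p∣toℕ⇒≡0F y) (euclidsLemma (toℕ x) (toℕ y) pr p∣xy)
    where
    p∣xy : p ∣ toℕ x * toℕ y
    p∣xy = m%n≡0⇒n∣m _ p (trans (sym (toℕ-reduce _)) (trans (cong toℕ xy≡0) toℕ-0F))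

  *F-cancelˡ : ∀ {c x y} → c ≢ 0F → c *F x ≡ c *F y → x ≡ y
  *F-cancelˡ {c} {x} {y} c≢0 cx≡cy with *F-zero-divisor c[x-y]≡0
    where
    c[x-y]≡0 : c *F (x +F negF y) ≡ 0F
    c[x-y]≡0 = begin
      c *F (x +F negF y)            ≡⟨ *F-distribˡ-+F c x (negF y) ⟩
      c *F x +F c *F negF y         ≡⟨ cong (_+F c *F negF y) cx≡cy ⟩
      c *F y +F c *F negF y         ≡⟨ *F-distribˡ-+F c y (negF y) ⟨
      c *F (y +F negF y)            ≡⟨ cong (c *F_) (negF-inverseʳ y) ⟩
      c *F 0F                       ≡⟨ *F-zeroʳ c ⟩
      0F                            ∎
      where open ≡-Reasoning
  ... | inj₁ c≡0   = ⊥-elim (c≢0 c≡0)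
  ... | inj₂ x-y≡0 = x+negF-y≡0⇒x≡y x y x-y≡0

  -- Multiplication by c is injective on the finite set F, so every value has exactly one preimage.
  *F-inverse : ∀ {c} → c ≢ 0F → ∃ λ c⁻¹ → c *F c⁻¹ ≡ 1F
  *F-inverse {c} c≢0 =
    let c⁻¹ , δ>0 = sum>0⇒∃ (λ y → δ (c *F y) 1F) (≤-reflexive (sym (preimages≡1 1F)))
    in  c⁻¹ , ⟦⟧>0⇒ (c *F c⁻¹ ≟ 1F) δ>0
    where
    preimages : F → ℕ
    preimages z = ∑[ y < p ] δ (c *F y) z
    preimages≤1 : ∀ z → preimages z ≤ 1
    preimages≤1 z = sum-≤1 (λ y → δ (c *F y) z) (λ y → ⟦⟧≤1 (c *F y ≟ z))
      λ y y′ cy≡z cy′≡z →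
        *F-cancelˡ c≢0 (trans (⟦⟧≡1⇒ (c *F y ≟ z) cy≡z) (sym (⟦⟧≡1⇒ (c *F y′ ≟ z) cy′≡z)))
    preimages≡1 : ∀ z → preimages z ≡ 1
    preimages≡1 = sum-≤-≡⇒≡ preimages≤1
      (trans (∑-comm (λ z y → δ (c *F y) z)) (sum-cong-≗ (λ y → sum-δ≡1 (c *F y))))

  scaling : ∀ {c} → c ≢ 0F → Permutation p p
  scaling {c} c≢0 =
    let c⁻¹ , cc⁻¹≡1 = *F-inverse c≢0
    in  permutation (c *F_) (c⁻¹ *F_)
                    (cancel c c⁻¹ cc⁻¹≡1) (cancel c⁻¹ c (trans (*F-comm c⁻¹ c) cc⁻¹≡1))
    where
    cancel : ∀ a b → a *F b ≡ 1F → ∀ y → a *F (b *F y) ≡ y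
    cancel a b ab≡1 y = trans (sym (*F-assoc a b y)) (trans (cong (_*F y) ab≡1) (*F-identityˡ y))

  sum-scale : ∀ {c} → c ≢ 0F → ∀ (h : F → ℕ) → ∑[ x < p ] h (c *F x) ≡ sum h
  sum-scale c≢0 h = sym (∑-permute h (scaling c≢0))

  δ-*F-cancel : ∀ {c} → c ≢ 0F → ∀ y z → δ (c *F y) (c *F z) ≡ δ y z
  δ-*F-cancel {c} c≢0 y z = ⟦⟧-cong (c *F y ≟ c *F z) (y ≟ z) (*F-cancelˡ c≢0) (cong (c *F_))

  square-roots : ∀ {y z} → y *F y ≡ z *F z → y ≡ z ⊎ y ≡ negF z
  square-roots {y} {z} y²≡z² with *F-zero-divisor d[y+z]≡0
    where
    d : F
    d = y -F z
    d[y+z]≡0 : d *F (y +F z) ≡ 0F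
    d[y+z]≡0 = +F-cancelʳ (z *F z) (d *F (y +F z)) 0F (begin
      d *F (y +F z) +F z *F z
        ≡⟨ cong (λ t → d *F (t +F z) +F z *F z) (x-y+y≡x y z) ⟨
      d *F ((d +F z) +F z) +F z *F z
        ≡⟨ solve 2 (λ d z → d :* ((d :+ z) :+ z) :+ z :* z := (d :+ z) :* (d :+ z)) refl d z ⟩
      (d +F z) *F (d +F z)
        ≡⟨ cong (λ t → t *F t) (x-y+y≡x y z) ⟩
      y *F y
        ≡⟨ y²≡z² ⟩
      z *F z
        ≡⟨ +F-identityˡ (z *F z) ⟨
      0F +F z *F z
        ∎)
      where open ≡-Reasoning
  ... | inj₁ d≡0   = inj₁ (-F≡0⇒≡ d≡0)
  ... | inj₂ y+z≡0 = inj₂ (+F≡0⇒≡negF y z y+z≡0)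

module QuadraticResidues (p : ℕ) (pr : Prime p) where
  open Fp p pr
  open PrimeField p pr

  isQR? : ∀ x → Dec (IsQR x)
  isQR? x = ¬? (x ≟ 0F) ×-dec any? (λ y → y *F y ≟ x)

  isQNR? : ∀ x → Dec (IsQNR x)
  isQNR? x = ¬? (x ≟ 0F) ×-dec ¬? (any? (λ y → y *F y ≟ x))

  QR⊎QNR : ∀ {x} → x ≢ 0F → IsQR x ⊎ IsQNR x
  QR⊎QNR {x} x≢0 with any? (λ y → y *F y ≟ x)
  ... | yes root = inj₁ (x≢0 , root)
  ... | no ¬root = inj₂ (x≢0 , ¬root)

  χQR : F → ℕ
  χQR x = ⟦ isQR? x ⟧

  χQNR : F → ℕ
  χQNR x = ⟦ isQNR? x ⟧

  QR≢0 : ∀ {x} → IsQR x → x ≢ 0F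
  QR≢0 = proj₁

  square-≢0 : ∀ {y} → y ≢ 0F → y *F y ≢ 0F
  square-≢0 y≢0 y²≡0 with *F-zero-divisor y²≡0
  ... | inj₁ y≡0 = y≢0 y≡0
  ... | inj₂ y≡0 = y≢0 y≡0

  square-QR : ∀ {y} → y ≢ 0F → IsQR (y *F y)
  square-QR {y} y≢0 = square-≢0 y≢0 , y , refl

  QR-* : ∀ {x y} → IsQR x → IsQR y → IsQR (x *F y)
  QR-* {x} {y} (x≢0 , a , a²≡x) (y≢0 , b , b²≡y) = xy≢0 , a *F b , (begin
    (a *F b) *F (a *F b)    ≡⟨ solve 2 (λ a b → (a :* b) :* (a :* b) := (a :* a) :* (b :* b)) refl a b ⟩
    (a *F a) *F (b *F b)    ≡⟨ cong₂ _*F_ a²≡x b²≡y ⟩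
    x *F y                  ∎)
    where
    open ≡-Reasoning
    xy≢0 : x *F y ≢ 0F
    xy≢0 xy≡0 with *F-zero-divisor xy≡0
    ... | inj₁ x≡0 = x≢0 x≡0
    ... | inj₂ y≡0 = y≢0 y≡0

  -- The inverse of z * z is w * w for w the inverse of z.
  QR-inverse : ∀ {c c′} → IsQR c → c *F c′ ≡ 1F → IsQR c′
  QR-inverse {c} {c′} (c≢0 , z , z²≡c) cc′≡1 =
    let w , zw≡1 = *F-inverse z≢0 in c′≢0 , w , w²≡c′ w zw≡1
    where
    open ≡-Reasoning
    z≢0 : z ≢ 0F
    z≢0 z≡0 = c≢0 (trans (sym z²≡c) (trans (cong (_*F z) z≡0) (*F-zeroˡ z)))
    c′≢0 : c′ ≢ 0F
    c′≢0 c′≡0 = 1F≢0F (trans (sym cc′≡1) (trans (cong (c *F_) c′≡0) (*F-zeroʳ c)))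
    w²≡c′ : ∀ w → z *F w ≡ 1F → w *F w ≡ c′
    w²≡c′ w zw≡1 = begin
      w *F w
        ≡⟨ *F-identityˡ (w *F w) ⟨
      1F *F (w *F w)
        ≡⟨ cong (_*F (w *F w)) (trans (sym cc′≡1) (*F-comm c c′)) ⟩
      (c′ *F c) *F (w *F w)
        ≡⟨ cong (λ t → (c′ *F t) *F (w *F w)) (sym z²≡c) ⟩
      (c′ *F (z *F z)) *F (w *F w)
        ≡⟨ solve 3 (λ c′ z w → (c′ :* (z :* z)) :* (w :* w) := c′ :* ((z :* w) :* (z :* w))) refl c′ z w ⟩
      c′ *F ((z *F w) *F (z *F w))
        ≡⟨ cong (λ t → c′ *F (t *F t)) zw≡1 ⟩
      c′ *F (1F *F 1F)
        ≡⟨ cong (c′ *F_) (*F-identityˡ 1F) ⟩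
      c′ *F 1F
        ≡⟨ *F-identityʳ c′ ⟩
      c′
        ∎

  QR-cancelˡ : ∀ {c y} → IsQR c → IsQR (c *F y) → IsQR y
  QR-cancelˡ {c} {y} c∈R cy∈R =
    let c′ , cc′≡1 = *F-inverse (QR≢0 c∈R)
    in  subst IsQR (c′[cy]≡y c′ cc′≡1) (QR-* (QR-inverse c∈R cc′≡1) cy∈R)
    where
    c′[cy]≡y : ∀ c′ → c *F c′ ≡ 1F → c′ *F (c *F y) ≡ y
    c′[cy]≡y c′ cc′≡1 = trans (sym (*F-assoc c′ c y))
                              (trans (cong (_*F y) (trans (*F-comm c′ c) cc′≡1)) (*F-identityˡ y))

  χQR-scale : ∀ {c} → IsQR c → ∀ y → χQR (c *F y) ≡ χQR y
  χQR-scale {c} c∈R y = ⟦⟧-cong (isQR? (c *F y)) (isQR? y) (QR-cancelˡ c∈R) (QR-* c∈R)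

  negF² : ∀ z → negF z *F negF z ≡ z *F z
  negF² z = +F-cancelʳ (z *F negF z) (negF z *F negF z) (z *F z) (trans lhs≡0 (sym rhs≡0))
    where
    lhs≡0 : negF z *F negF z +F z *F negF z ≡ 0F
    lhs≡0 = trans (sym (*F-distribʳ-+F (negF z) (negF z) z))
                  (trans (cong (_*F negF z) (negF-inverseˡ z)) (*F-zeroˡ (negF z)))
    rhs≡0 : z *F z +F z *F negF z ≡ 0F
    rhs≡0 = trans (sym (*F-distribˡ-+F z z (negF z)))
                  (trans (cong (z *F_) (negF-inverseʳ z)) (*F-zeroʳ z))

  R : ℕ
  R = sum χQR

  trichotomy : ∀ x → δ 0F x + (χQR x + χQNR x) ≡ 1
  trichotomy x with 0F ≟ x
  ... | yes refl = cong₂ (λ a b → 1 + (a + b)) (⟦no⟧ (isQR? 0F) (λ 0∈R → proj₁ 0∈R refl))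
                                               (⟦no⟧ (isQNR? 0F) (λ 0∈N → proj₁ 0∈N refl))
  ... | no 0≢x with isQR? x
  ...   | yes x∈R = cong₂ _+_ (⟦yes⟧ (isQR? x) x∈R)
                              (⟦no⟧ (isQNR? x) (λ x∈N → proj₂ x∈N (proj₂ x∈R)))
  ...   | no x∉R  = cong₂ _+_ (⟦no⟧ (isQR? x) x∉R)
                              (⟦yes⟧ (isQNR? x) (0≢x ∘ sym , λ root → x∉R (0≢x ∘ sym , root)))

  module _ {ν} (ν∈N : IsQNR ν) where

    -- In F₂ every element is a square, so a non-residue forces p ≠ 2.
    1F+1F≢0F : 1F +F 1F ≢ 0F
    1F+1F≢0F 2≡0 = proj₂ ν∈N (ν , idempotent ν)
      where
      p∣2 : p ∣ 2
      p∣2 = m%n≡0⇒n∣m 2 p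
        (trans (sym (trans (toℕ-reduce _) (cong (_% p) (cong₂ _+_ toℕ-1F toℕ-1F))))
               (trans (cong toℕ 2≡0) toℕ-0F))
      p≡2 : p ≡ 2
      p≡2 = ≤-antisym (∣⇒≤ p∣2) 1<p
      n<2⇒n*n≡n : ∀ n → n < 2 → n * n ≡ n
      n<2⇒n*n≡n zero          _ = refl
      n<2⇒n*n≡n (suc zero)    _ = refl
      n<2⇒n*n≡n (suc (suc _)) (s≤s (s≤s ()))
      idempotent : ∀ x → x *F x ≡ x
      idempotent x = toℕ-injective (trans (toℕ-reduce _)
        (trans (cong (_% p) (n<2⇒n*n≡n (toℕ x) (subst (toℕ x <_) p≡2 (toℕ<n x))))
               (m<n⇒m%n≡m (toℕ<n x))))

    negF-≢ : ∀ {z} → z ≢ 0F → negF z ≢ z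
    negF-≢ {z} z≢0 -z≡z with *F-zero-divisor 2z≡0
      where
      2z≡0 : (1F +F 1F) *F z ≡ 0F
      2z≡0 = begin
        (1F +F 1F) *F z          ≡⟨ *F-distribʳ-+F z 1F 1F ⟩
        1F *F z +F 1F *F z       ≡⟨ cong₂ _+F_ (*F-identityˡ z) (*F-identityˡ z) ⟩
        z +F z                   ≡⟨ cong (_+F z) -z≡z ⟨
        negF z +F z              ≡⟨ negF-inverseˡ z ⟩
        0F                       ∎
        where open ≡-Reasoning
    ... | inj₁ 2≡0 = 1F+1F≢0F 2≡0
    ... | inj₂ z≡0 = z≢0 z≡0

    -- A non-zero square z² has exactly the two square roots z and -z.
    #square-roots : ∀ x → ∑[ y < p ] δ (y *F y) x ≡ δ 0F x + (χQR x + χQR x)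
    #square-roots x with 0F ≟ x
    ... | yes refl = begin
      ∑[ y < p ] δ (y *F y) 0F
        ≡⟨ sum-cong-≗ (λ y → ⟦⟧-cong (y *F y ≟ 0F) (0F ≟ y) y²≡0⇒0≡y 0≡y⇒y²≡0) ⟩
      sum (δ 0F)
        ≡⟨ sum-δ≡1 0F ⟩
      1
        ≡⟨ cong (λ b → 1 + (b + b)) (⟦no⟧ (isQR? 0F) (λ 0∈R → QR≢0 0∈R refl)) ⟨
      1 + (χQR 0F + χQR 0F)
        ∎
      where
      open ≡-Reasoning
      y²≡0⇒0≡y : ∀ {y} → y *F y ≡ 0F → 0F ≡ y
      y²≡0⇒0≡y y²≡0 with *F-zero-divisor y²≡0
      ... | inj₁ y≡0 = sym y≡0
      ... | inj₂ y≡0 = sym y≡0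
      0≡y⇒y²≡0 : ∀ {y} → 0F ≡ y → y *F y ≡ 0F
      0≡y⇒y²≡0 refl = *F-zeroˡ 0F
    ... | no 0≢x with isQR? x
    ...   | no x∉R = trans (sum-zero {p} (λ y → δ-≢ (λ y²≡x → x∉R ((0≢x ∘ sym) , y , y²≡x))))
                             (sym (cong (λ b → b + b) (⟦no⟧ (isQR? x) x∉R)))
    ...   | yes x∈R@(_ , z , z²≡x) = begin
      ∑[ y < p ] δ (y *F y) x                 ≡⟨ sum-cong-≗ roots ⟩
      ∑[ y < p ] (δ z y + δ (negF z) y)       ≡⟨ ∑-distrib-+ (δ z) (δ (negF z)) ⟩
      sum (δ z) + sum (δ (negF z))            ≡⟨ cong₂ _+_ (sum-δ≡1 z) (sum-δ≡1 (negF z)) ⟩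
      1 + 1                                   ≡⟨ cong (λ b → b + b) (⟦yes⟧ (isQR? x) x∈R) ⟨
      χQR x + χQR x                           ∎
      where
      open ≡-Reasoning
      z≢0 : z ≢ 0F
      z≢0 z≡0 = 0≢x (trans (sym (*F-zeroˡ 0F)) (trans (cong (λ t → t *F t) (sym z≡0)) z²≡x))
      roots : ∀ y → δ (y *F y) x ≡ δ z y + δ (negF z) y
      roots y with y ≟ z | y ≟ negF z
      ... | yes refl | yes y≡-y = ⊥-elim (negF-≢ z≢0 (sym y≡-y))
      ... | yes refl | no y≢-y  = trans (⟦yes⟧ (y *F y ≟ x) z²≡x)
                                    (sym (cong₂ _+_ (δ-refl y) (δ-≢ (λ -y≡y → y≢-y (sym -y≡y)))))
      ... | no y≢z   | yes refl = trans (⟦yes⟧ (y *F y ≟ x) (trans (negF² z) z²≡x))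
                                    (sym (cong₂ _+_ (δ-≢ (λ z≡y → y≢z (sym z≡y))) (δ-refl y)))
      ... | no y≢z   | no y≢-z  =
        trans (δ-≢ (λ y²≡x → [ y≢z , y≢-z ]′ (square-roots (trans y²≡x (sym z²≡x)))))
              (sym (cong₂ _+_ (δ-≢ (y≢z ∘ sym)) (δ-≢ (y≢-z ∘ sym))))

    p≡1+2R : p ≡ 1 + (R + R)
    p≡1+2R = begin
      p                                          ≡⟨ trans (sum-const p 1) (*-identityʳ p) ⟨
      ∑[ y < p ] 1                               ≡⟨ sum-cong-≗ (λ y → sum-δ≡1 (y *F y)) ⟨
      ∑[ y < p ] ∑[ x < p ] δ (y *F y) x         ≡⟨ ∑-comm (λ y x → δ (y *F y) x) ⟩
      ∑[ x < p ] ∑[ y < p ] δ (y *F y) x         ≡⟨ sum-cong-≗ #square-roots ⟩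
      ∑[ x < p ] (δ 0F x + (χQR x + χQR x))      ≡⟨ sum-δ+f+g 0F χQR χQR ⟩
      1 + (R + R)                                ∎
      where open ≡-Reasoning

    sum-χQNR : sum χQNR ≡ R
    sum-χQNR = +-cancelˡ-≡ R _ _ (+-cancelˡ-≡ 1 _ _ (trans (sym p≡1+R+N) p≡1+2R))
      where
      open ≡-Reasoning
      p≡1+R+N : p ≡ 1 + (R + sum χQNR)
      p≡1+R+N = begin
        p                                        ≡⟨ trans (sum-const p 1) (*-identityʳ p) ⟨
        ∑[ x < p ] 1                             ≡⟨ sum-cong-≗ trichotomy ⟨
        ∑[ x < p ] (δ 0F x + (χQR x + χQNR x))   ≡⟨ sum-δ+f+g 0F χQR χQNR ⟩
        1 + (R + sum χQNR)                       ∎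

    -- Multiplication by ν maps residues to non-residues, and both classes have R elements.
    χQR-ν* : ∀ x → χQR (ν *F x) ≡ χQNR x
    χQR-ν* = sum-≤-≡⇒≡ (λ x → ⟦⟧-mono (isQR? (ν *F x)) (isQNR? x) (νx∈R⇒x∈N x))
                      (trans (sum-scale (proj₁ ν∈N) χQR) (sym sum-χQNR))
      where
      νx∈R⇒x∈N : ∀ x → IsQR (ν *F x) → IsQNR x
      νx∈R⇒x∈N x νx∈R =
        x≢0 , λ root → proj₂ ν∈N (proj₂ (QR-cancelˡ (x≢0 , root) (subst IsQR (*F-comm ν x) νx∈R)))
        where
        x≢0 : x ≢ 0F
        x≢0 x≡0 = QR≢0 νx∈R (trans (cong (ν *F_) x≡0) (*F-zeroʳ ν))

    QNR⇒ν*QR : ∀ {x} → IsQNR x → ∃ λ t → IsQR t × x ≡ ν *F t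
    QNR⇒ν*QR {x} x∈N = let w , νw≡1 = *F-inverse (proj₁ ν∈N) in
      (w *F w) *F (ν *F x) , QR-* (square-QR (w≢0 νw≡1)) νx∈R , sym (ν[w²νx]≡x νw≡1)
      where
      νx∈R : IsQR (ν *F x)
      νx∈R = ⟦⟧≡1⇒ (isQR? (ν *F x)) (trans (χQR-ν* x) (⟦yes⟧ (isQNR? x) x∈N))
      w≢0 : ∀ {w} → ν *F w ≡ 1F → w ≢ 0F
      w≢0 νw≡1 w≡0 = 1F≢0F (trans (sym νw≡1) (trans (cong (ν *F_) w≡0) (*F-zeroʳ ν)))
      ν[w²νx]≡x : ∀ {w} → ν *F w ≡ 1F → ν *F ((w *F w) *F (ν *F x)) ≡ x
      ν[w²νx]≡x {w} νw≡1 = begin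
        ν *F ((w *F w) *F (ν *F x))
          ≡⟨ solve 3 (λ v w x → v :* ((w :* w) :* (v :* x)) := ((v :* w) :* (v :* w)) :* x) refl ν w x ⟩
        ((ν *F w) *F (ν *F w)) *F x
          ≡⟨ cong (λ t → (t *F t) *F x) νw≡1 ⟩
        (1F *F 1F) *F x
          ≡⟨ trans (cong (_*F x) (*F-identityˡ 1F)) (*F-identityˡ x) ⟩
        x
          ∎
        where open ≡-Reasoning

module DifferenceCounts (p : ℕ) (pr : Prime p) where
  open Fp p pr

  sum-pairs : ∀ S (h : F → F → ℕ) →
    sumˡ (map (λ uv → h (proj₁ uv) (proj₂ uv)) (cartesianProduct (elems S) (elems S)))
    ≡ pairSum (χ S) h
  sum-pairs S h = trans (sum-map-cartesianProduct _ (elems S) (elems S))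
    (trans (sum-map-members S (λ u → sumˡ (map (λ v → h u v) (elems S))))
           (sum-cong-≗ (λ u → cong (χ S u *_) (sum-map-members S (h u)))))

  diffCount≡pairSum : ∀ S x → diffCount S x ≡ pairSum (χ S) (λ u v → δ (u -F v) x)
  diffCount≡pairSum S x = trans (length-filter≡sum _ (cartesianProduct (elems S) (elems S)))
                                (sum-pairs S (λ u v → δ (u -F v) x))

  diffCount≡1⇒∃ : ∀ S x → diffCount S x ≡ 1 → ∃ λ u → ∃ λ v → u ∈ S × v ∈ S × u -F v ≡ x
  diffCount≡1⇒∃ S x count≡1
    with (u , v) , uv∈ ← length≡1⇒∃∈
           {xs = filter (λ uv → proj₁ uv -F proj₂ uv ≟ x) (cartesianProduct (elems S) (elems S))}
           count≡1
    with uv∈pairs , u-v≡x ← ∈-filter⁻ (λ uv → proj₁ uv -F proj₂ uv ≟ x) uv∈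
    with u∈elems , v∈elems ← ∈-cartesianProduct⁻ (elems S) (elems S) uv∈pairs
    = u , v , proj₂ (∈-filter⁻ (_∈? S) {xs = allFin p} u∈elems)
            , proj₂ (∈-filter⁻ (_∈? S) {xs = allFin p} v∈elems) , u-v≡x

module SumSetConstruction (p : ℕ) (pr : Prime p) (A : Subset p) (ν : Fp.F p pr)
                          (A-A≐R : Fp.DiffExactlyQR p pr A) (ν∈N : Fp.IsQNR p pr ν) where
  open Fp p pr
  open PrimeField p pr
  open QuadraticResidues p pr
  open DifferenceCounts p pr

  A-A⊆R : ∀ {a a′} → a ∈ A → a′ ∈ A → a ≢ a′ → IsQR (a -F a′)
  A-A⊆R = proj₂ A-A≐R _ _

  -- −1 = v − u for the pair u − v = 1 in A, so −1 is a residue.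
  negF1∈R : IsQR (negF 1F)
  negF1∈R
    with u , v , u∈A , v∈A , u-v≡1 ←
           diffCount≡1⇒∃ A 1F (proj₁ A-A≐R 1F (1F≢0F , 1F , *F-identityˡ 1F))
    = subst IsQR v-u≡-1 (A-A⊆R v∈A u∈A v≢u)
    where
    u≡1+v : u ≡ 1F +F v
    u≡1+v = trans (sym (x-y+y≡x u v)) (cong (_+F v) u-v≡1)
    v-u≡-1 : v -F u ≡ negF 1F
    v-u≡-1 = +F≡0⇒≡negF (v -F u) 1F (+F-cancelʳ v _ _ (begin
      ((v -F u) +F 1F) +F v     ≡⟨ +F-assoc (v -F u) 1F v ⟩
      (v -F u) +F (1F +F v)     ≡⟨ cong ((v -F u) +F_) u≡1+v ⟨
      (v -F u) +F u             ≡⟨ x-y+y≡x v u ⟩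
      v                         ≡⟨ +F-identityˡ v ⟨
      0F +F v                   ∎))
      where open ≡-Reasoning
    v≢u : v ≢ u
    v≢u v≡u = 1F≢0F (trans (sym u-v≡1) (trans (cong (u -F_) v≡u) (-F-self u)))

  -- r + ν s = 0 would make ν s = (−1) r a residue.
  R+νR∌0 : ∀ {r s} → IsQR r → IsQR s → r +F ν *F s ≢ 0F
  R+νR∌0 {r} {s} r∈R s∈R r+νs≡0 =
    proj₂ ν∈N (proj₂ (QR-cancelˡ s∈R (subst IsQR sν≡-r (QR-* negF1∈R r∈R))))
    where
    sν≡-r : negF 1F *F r ≡ s *F ν
    sν≡-r = trans (negF1*x≡negF-x r) (trans (sym (+F≡0⇒≡negFʳ r (ν *F s) r+νs≡0)) (*F-comm ν s))

  difference-of-sums : ∀ a₁ b₁ a₂ b₂ →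
                       (a₁ +F ν *F b₁) -F (a₂ +F ν *F b₂) ≡ (a₁ -F a₂) +F ν *F (b₁ -F b₂)
  difference-of-sums a₁ b₁ a₂ b₂ = begin
    (a₁ +F ν *F b₁) -F c₂
      ≡⟨ cong₂ (λ a b → (a +F ν *F b) -F c₂) (x-y+y≡x a₁ a₂) (x-y+y≡x b₁ b₂) ⟨
    ((r +F a₂) +F ν *F (s +F b₂)) -F c₂
      ≡⟨ cong (_-F c₂) (regroup r a₂ s b₂ ν) ⟩
    ((r +F ν *F s) +F c₂) -F c₂
      ≡⟨ x+y-y≡x (r +F ν *F s) c₂ ⟩
    r +F ν *F s
      ∎
    where
    open ≡-Reasoning
    r s c₂ : F
    r = a₁ -F a₂
    s = b₁ -F b₂
    c₂ = a₂ +F ν *F b₂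
    regroup : ∀ r a s b v → (r +F a) +F v *F (s +F b) ≡ (r +F v *F s) +F (a +F v *F b)
    regroup = solve 5 (λ r a s b v → (r :+ a) :+ v :* (s :+ b) := (r :+ v :* s) :+ (a :+ v :* b)) refl

  sum-injective : ∀ {a₁ b₁ a₂ b₂} → a₁ ∈ A → b₁ ∈ A → a₂ ∈ A → b₂ ∈ A →
                  a₁ +F ν *F b₁ ≡ a₂ +F ν *F b₂ → a₁ ≡ a₂ × b₁ ≡ b₂
  sum-injective {a₁} {b₁} {a₂} {b₂} a₁∈A b₁∈A a₂∈A b₂∈A eq = cases (a₁ ≟ a₂) (b₁ ≟ b₂)
    where
    r s : F
    r = a₁ -F a₂
    s = b₁ -F b₂
    r+νs≡0 : r +F ν *F s ≡ 0F
    r+νs≡0 = trans (sym (difference-of-sums a₁ b₁ a₂ b₂))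
                   (trans (cong (_-F (a₂ +F ν *F b₂)) eq) (-F-self (a₂ +F ν *F b₂)))
    cases : Dec (a₁ ≡ a₂) → Dec (b₁ ≡ b₂) → a₁ ≡ a₂ × b₁ ≡ b₂
    cases (yes a₁≡a₂) (yes b₁≡b₂) = a₁≡a₂ , b₁≡b₂
    cases (no a₁≢a₂)  (no b₁≢b₂)  =
      ⊥-elim (R+νR∌0 (A-A⊆R a₁∈A a₂∈A a₁≢a₂) (A-A⊆R b₁∈A b₂∈A b₁≢b₂) r+νs≡0)
    cases (yes a₁≡a₂) (no b₁≢b₂) with *F-zero-divisor νs≡0
      where
      νs≡0 : ν *F s ≡ 0F
      νs≡0 = begin
        ν *F s          ≡⟨ +F-identityˡ (ν *F s) ⟨
        0F +F ν *F s    ≡⟨ cong (λ t → t +F ν *F s) (trans (cong (_-F a₂) a₁≡a₂) (-F-self a₂)) ⟨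
        r +F ν *F s     ≡⟨ r+νs≡0 ⟩
        0F              ∎
        where open ≡-Reasoning
    ... | inj₁ ν≡0 = ⊥-elim (proj₁ ν∈N ν≡0)
    ... | inj₂ s≡0 = ⊥-elim (QR≢0 (A-A⊆R b₁∈A b₂∈A b₁≢b₂) s≡0)
    cases (no a₁≢a₂) (yes b₁≡b₂) = ⊥-elim (QR≢0 (A-A⊆R a₁∈A a₂∈A a₁≢a₂) (begin
      r                   ≡⟨ +F-identityʳ r ⟨
      r +F 0F             ≡⟨ cong (r +F_) (*F-zeroʳ ν) ⟨
      r +F ν *F 0F        ≡⟨ cong (λ t → r +F ν *F t) (trans (cong (_-F b₂) b₁≡b₂) (-F-self b₂)) ⟨
      r +F ν *F s         ≡⟨ r+νs≡0 ⟩
      0F                  ∎))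
      where open ≡-Reasoning

  n : ℕ
  n = ∣ A ∣

  D : Subset p
  D = sumSet A ν

  #differences : F → ℕ
  #differences r = pairSum (χ A) (λ u v → δ (u -F v) r)

  #differences≡ : ∀ r → #differences r ≡ n * δ 0F r + χQR r
  #differences≡ r with 0F ≟ r
  ... | yes refl = begin
    pairSum (χ A) (λ u v → δ (u -F v) 0F)
      ≡⟨ pairSum-cong (χ A) (λ u v →
           ⟦⟧-cong (u -F v ≟ 0F) (u ≟ v) -F≡0⇒≡ (λ { refl → -F-self u })) ⟩
    ∑[ u < p ] (χ A u * ∑[ v < p ] (χ A v * δ u v))
      ≡⟨ sum-cong-≗ (λ u → cong (χ A u *_)
           (trans (sum-cong-≗ (λ v → *-comm (χ A v) (δ u v))) (sum-δ u (χ A)))) ⟩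
    ∑[ u < p ] (χ A u * χ A u)
      ≡⟨ sum-cong-≗ (λ u → ⟦⟧-idem (u ∈? A)) ⟩
    sum (χ A)
      ≡⟨ ∣∣≡sum-χ A ⟨
    n
      ≡⟨ trans (cong₂ _+_ (*-identityʳ n) (⟦no⟧ (isQR? 0F) (λ 0∈R → QR≢0 0∈R refl))) (+-identityʳ n) ⟨
    n * 1 + χQR 0F
      ∎
    where open ≡-Reasoning
  ... | no 0≢r with isQR? r
  ...   | yes r∈R = trans (sym (diffCount≡pairSum A r))
                      (trans (proj₁ A-A≐R r r∈R) (sym (cong₂ _+_ (*-zeroʳ n) (⟦yes⟧ (isQR? r) r∈R))))
  ...   | no r∉R = trans (pairSum-zero (χ A) (λ u → ⟦⟧≤1 (u ∈? A)) _ no-difference)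
                     (sym (cong₂ _+_ (*-zeroʳ n) (⟦no⟧ (isQR? r) r∉R)))
    where
    no-difference : ∀ u v → χ A u ≡ 1 → χ A v ≡ 1 → δ (u -F v) r ≡ 0
    no-difference u v u∈A v∈A = δ-≢ λ u-v≡r → case u ≟ v of λ
      { (yes refl) → 0≢r (trans (sym (-F-self u)) u-v≡r)
      ; (no u≢v)   → r∉R (subst IsQR u-v≡r (A-A⊆R (⟦⟧≡1⇒ (u ∈? A) u∈A) (⟦⟧≡1⇒ (v ∈? A) v∈A) u≢v)) }

  #representations : F → ℕ
  #representations x = pairSum (χ A) (λ a b → δ (a +F ν *F b) x)

  #representations≤1 : ∀ x → #representations x ≤ 1
  #representations≤1 x = pairSum-≤1 (χ A) (λ u → ⟦⟧≤1 (u ∈? A)) _ (λ a b → ⟦⟧≤1 (a +F ν *F b ≟ x))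
    λ (a₁∈A , b₁∈A , e₁) (a₂∈A , b₂∈A , e₂) → sum-injective (∈ a₁∈A) (∈ b₁∈A) (∈ a₂∈A) (∈ b₂∈A)
                                                 (trans (⟦⟧≡1⇒ (_ ≟ x) e₁) (sym (⟦⟧≡1⇒ (_ ≟ x) e₂)))
    where
    ∈ : ∀ {a} → χ A a ≡ 1 → a ∈ A
    ∈ {a} = ⟦⟧≡1⇒ (a ∈? A)

  χD≡#representations : ∀ x → χ D x ≡ #representations x
  χD≡#representations x = begin
    χ D x
      ≡⟨ χ≡𝟙∘lookup D x ⟩
    𝟙 (lookup D x)
      ≡⟨ cong 𝟙 (lookup∘tabulate _ x) ⟩
    𝟙 (any hits pairs)
      ≡⟨ 𝟙-any hits pairs (subst (_≤ 1) (sym (sum-pairs A H)) (#representations≤1 x)) ⟩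
    sumˡ (map (𝟙 ∘ hits) pairs)
      ≡⟨ sum-pairs A H ⟩
    #representations x
      ∎
    where
    open ≡-Reasoning
    pairs : List (F × F)
    pairs = cartesianProduct (elems A) (elems A)
    hits : F × F → Bool
    hits ab = does (proj₁ ab +F ν *F proj₂ ab ≟ x)
    H : F → F → ℕ
    H a b = δ (a +F ν *F b) x

  ∣D∣≡n² : ∣ D ∣ ≡ n * n
  ∣D∣≡n² = begin
    ∣ D ∣                        ≡⟨ ∣∣≡sum-χ D ⟩
    sum (χ D)                    ≡⟨ sum-cong-≗ χD≡#representations ⟩
    sum #representations         ≡⟨ sum-pairSum-δ (χ A) (λ a b → a +F ν *F b) ⟩
    sum (χ A) * sum (χ A)        ≡⟨ cong₂ _*_ (∣∣≡sum-χ A) (∣∣≡sum-χ A) ⟨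
    n * n                        ∎
    where open ≡-Reasoning

  -- (a₁ + ν b₁) − (a₂ + ν b₂) = (a₁ − a₂) + ν (b₁ − b₂), and each difference r arises #differences r times.
  diffCount-D : ∀ x → diffCount D x ≡ pairSum #differences (λ r s → δ (r +F ν *F s) x)
  diffCount-D x = begin
    diffCount D x
      ≡⟨ diffCount≡pairSum D x ⟩
    pairSum (χ D) (λ u v → δ (u -F v) x)
      ≡⟨ pairSum-congʷ (λ u v → δ (u -F v) x) χD≡#representations ⟩
    ∑[ u < p ] (#representations u * ∑[ v < p ] (#representations v * δ (u -F v) x))
      ≡⟨ sum-cong-≗ (λ u → cong (#representations u *_) (sum-fibres (χ A) φ (λ v → δ (u -F v) x))) ⟩
    ∑[ u < p ] (#representations u * pairSum (χ A) (λ a₂ b₂ → δ (u -F φ a₂ b₂) x))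
      ≡⟨ sum-fibres (χ A) φ (λ u → pairSum (χ A) (λ a₂ b₂ → δ (u -F φ a₂ b₂) x)) ⟩
    pairSum (χ A) (λ a₁ b₁ → pairSum (χ A) (λ a₂ b₂ → δ (φ a₁ b₁ -F φ a₂ b₂) x))
      ≡⟨ pairSum-cong (χ A) (λ a₁ b₁ → pairSum-cong (χ A) (λ a₂ b₂ →
           cong (λ t → δ t x) (difference-of-sums a₁ b₁ a₂ b₂))) ⟩
    pairSum (χ A) (λ a₁ b₁ → pairSum (χ A) (λ a₂ b₂ → δ ((a₁ -F a₂) +F ν *F (b₁ -F b₂)) x))
      ≡⟨ pairSum-interchange (χ A) (λ a₁ b₁ a₂ b₂ → δ ((a₁ -F a₂) +F ν *F (b₁ -F b₂)) x) ⟩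
    pairSum (χ A) (λ a₁ a₂ → pairSum (χ A) (λ b₁ b₂ → δ ((a₁ -F a₂) +F ν *F (b₁ -F b₂)) x))
      ≡⟨ sum-fibres (χ A) _-F_ (λ r → pairSum (χ A) (λ b₁ b₂ → δ (r +F ν *F (b₁ -F b₂)) x)) ⟨
    ∑[ r < p ] (#differences r * pairSum (χ A) (λ b₁ b₂ → δ (r +F ν *F (b₁ -F b₂)) x))
      ≡⟨ sum-cong-≗ (λ r → cong (#differences r *_) (sum-fibres (χ A) _-F_ (λ s → δ (r +F ν *F s) x))) ⟨
    pairSum #differences (λ r s → δ (r +F ν *F s) x)
      ∎
    where
    open ≡-Reasoning
    φ : F → F → F
    φ a b = a +F ν *F b

  #R+νR : F → ℕ
  #R+νR x = pairSum χQR (λ r s → δ (r +F ν *F s) x)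

  #R+νR-0 : #R+νR 0F ≡ 0
  #R+νR-0 = pairSum-zero χQR (λ r → ⟦⟧≤1 (isQR? r)) _
    (λ r s r∈R s∈R → δ-≢ (R+νR∌0 (⟦⟧≡1⇒ (isQR? r) r∈R) (⟦⟧≡1⇒ (isQR? s) s∈R)))

  #R+νR-scale : ∀ {c} → IsQR c → ∀ x → #R+νR (c *F x) ≡ #R+νR x
  #R+νR-scale {c} c∈R x = begin
    #R+νR (c *F x)
      ≡⟨ sum-cong-≗ (λ r → cong (χQR r *_) (sum-scale c≢0 (λ s → χQR s * δ (r +F ν *F s) (c *F x)))) ⟨
    ∑[ r < p ] (χQR r * ∑[ s < p ] (χQR (c *F s) * δ (r +F ν *F (c *F s)) (c *F x)))
      ≡⟨ sum-scale c≢0 (λ r → χQR r * ∑[ s < p ] (χQR (c *F s) * δ (r +F ν *F (c *F s)) (c *F x))) ⟨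
    ∑[ r < p ] (χQR (c *F r) * ∑[ s < p ] (χQR (c *F s) * δ (c *F r +F ν *F (c *F s)) (c *F x)))
      ≡⟨ sum-cong-≗ (λ r → cong₂ _*_ (χQR-scale c∈R r)
                                      (sum-cong-≗ (λ s → cong₂ _*_ (χQR-scale c∈R s) (scaled r s)))) ⟩
    #R+νR x
      ∎
    where
    open ≡-Reasoning
    c≢0 : c ≢ 0F
    c≢0 = QR≢0 c∈R
    factor : ∀ c r v s → c *F r +F v *F (c *F s) ≡ c *F (r +F v *F s)
    factor = solve 4 (λ c r v s → c :* r :+ v :* (c :* s) := c :* (r :+ v :* s)) refl
    scaled : ∀ r s → δ (c *F r +F ν *F (c *F s)) (c *F x) ≡ δ (r +F ν *F s) x
    scaled r s = trans (cong (λ t → δ t (c *F x)) (factor c r ν s)) (δ-*F-cancel c≢0 _ _)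

  -- Substituting r = ν² t turns r + ν s = ν x into s + ν t = x, and ν² is a residue.
  #R+νR-ν : ∀ x → #R+νR (ν *F x) ≡ #R+νR x
  #R+νR-ν x = begin
    #R+νR (ν *F x)
      ≡⟨ sum-scale (QR≢0 ν²∈R) (λ r → χQR r * ∑[ s < p ] (χQR s * δ (r +F ν *F s) (ν *F x))) ⟨
    ∑[ t < p ] (χQR (ν² *F t) * ∑[ s < p ] (χQR s * δ (ν² *F t +F ν *F s) (ν *F x)))
      ≡⟨ sum-cong-≗ (λ t → cong₂ _*_ (χQR-scale ν²∈R t)
                                      (sum-cong-≗ (λ s → cong (χQR s *_) (swapped t s)))) ⟩
    pairSum χQR (λ t s → δ (s +F ν *F t) x)
      ≡⟨ pairSum-swap χQR (λ t s → δ (s +F ν *F t) x) ⟩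
    #R+νR x
      ∎
    where
    open ≡-Reasoning
    ν² : F
    ν² = ν *F ν
    ν²∈R : IsQR ν²
    ν²∈R = square-QR (proj₁ ν∈N)
    factor : ∀ v t s → (v *F v) *F t +F v *F s ≡ v *F (s +F v *F t)
    factor = solve 3 (λ v t s → (v :* v) :* t :+ v :* s := v :* (s :+ v :* t)) refl
    swapped : ∀ t s → δ (ν² *F t +F ν *F s) (ν *F x) ≡ δ (s +F ν *F t) x
    swapped t s = trans (cong (λ u → δ u (ν *F x)) (factor ν t s)) (δ-*F-cancel (proj₁ ν∈N) _ _)

  γ : ℕ
  γ = #R+νR 1F

  #R+νR-QR : ∀ {x} → IsQR x → #R+νR x ≡ γ
  #R+νR-QR {x} x∈R = trans (cong #R+νR (sym (*F-identityʳ x))) (#R+νR-scale x∈R 1F)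

  #R+νR-QNR : ∀ {x} → IsQNR x → #R+νR x ≡ γ
  #R+νR-QNR x∈N = let t , t∈R , x≡νt = QNR⇒ν*QR ν∈N x∈N in
    trans (cong #R+νR x≡νt) (trans (#R+νR-ν t) (#R+νR-QR t∈R))

  #R+νR-const : ∀ x → 0F ≢ x → #R+νR x ≡ γ
  #R+νR-const x 0≢x = [ #R+νR-QR , #R+νR-QNR ]′ (QR⊎QNR (0≢x ∘ sym))

  R>0 : 0 < R
  R>0 = subst (_≤ R) (⟦yes⟧ (isQR? 1F) (1F≢0F , 1F , *F-identityˡ 1F)) (≤-sum χQR 1F)

  -- Counting all pairs of residues by the value of r + ν s gives R² = (p − 1) γ = 2 R γ.
  R≡γ+γ : R ≡ γ + γ
  R≡γ+γ = *-cancelˡ-≡ R (γ + γ) R {{>-nonZero R>0}} (+-cancelʳ-≡ γ (R * R) (R * (γ + γ)) (begin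
    R * R + γ                ≡⟨ cong (_+ γ) (sum-pairSum-δ χQR (λ r s → r +F ν *F s)) ⟨
    sum #R+νR + γ            ≡⟨ sum-allBut 0F #R+νR γ #R+νR-const ⟩
    #R+νR 0F + p * γ         ≡⟨ cong₂ (λ a b → a + b * γ) #R+νR-0 (p≡1+2R ν∈N) ⟩
    (1 + (R + R)) * γ        ≡⟨ rearrange R γ ⟩
    R * (γ + γ) + γ          ∎))
    where
    open ≡-Reasoning
    rearrange : ∀ R γ → (1 + (R + R)) * γ ≡ R * (γ + γ) + γ
    rearrange = solve-∀

  n*n≡n+R : n * n ≡ n + R
  n*n≡n+R = begin
    n * n                                  ≡⟨ cong₂ _*_ (∣∣≡sum-χ A) (∣∣≡sum-χ A) ⟩
    sum (χ A) * sum (χ A)                  ≡⟨ sum-pairSum-δ (χ A) _-F_ ⟨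
    sum #differences                       ≡⟨ sum-cong-≗ #differences≡ ⟩
    ∑[ r < p ] (n * δ 0F r + χQR r)        ≡⟨ ∑-distrib-+ (λ r → n * δ 0F r) χQR ⟩
    ∑[ r < p ] (n * δ 0F r) + R            ≡⟨ cong (_+ R) (*-distribˡ-sum n (δ 0F)) ⟨
    n * sum (δ 0F) + R                     ≡⟨ cong (λ t → n * t + R) (sum-δ≡1 0F) ⟩
    n * 1 + R                              ≡⟨ cong (_+ R) (*-identityʳ n) ⟩
    n + R                                  ∎
    where open ≡-Reasoning

  #νR : F → ℕ
  #νR x = ∑[ s < p ] (χQR s * δ (ν *F s) x)

  #νR+χQR≡1 : ∀ x → 0F ≢ x → #νR x + χQR x ≡ 1
  #νR+χQR≡1 x 0≢x = [ on-R , on-N ]′ (QR⊎QNR (0≢x ∘ sym))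
    where
    open ≡-Reasoning
    on-R : IsQR x → #νR x + χQR x ≡ 1
    on-R x∈R = cong₂ _+_ (sum-zero {p} νs≢x) (⟦yes⟧ (isQR? x) x∈R)
      where
      νs∉R : ∀ {s} → IsQR s → ν *F s ≢ x
      νs∉R {s} s∈R νs≡x =
        proj₂ ν∈N (proj₂ (QR-cancelˡ s∈R (subst IsQR (trans (sym νs≡x) (*F-comm ν s)) x∈R)))
      νs≢x : ∀ s → χQR s * δ (ν *F s) x ≡ 0
      νs≢x s = [ (λ s∈R → trans (cong (χQR s *_) (δ-≢ (νs∉R s∈R))) (*-zeroʳ (χQR s)))
               , (λ s∉R → cong (_* δ (ν *F s) x) (⟦no⟧ (isQR? s) s∉R)) ]′ (toSum (isQR? s))
    on-N : IsQNR x → #νR x + χQR x ≡ 1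
    on-N x∈N = let t , t∈R , x≡νt = QNR⇒ν*QR ν∈N x∈N in begin
      #νR x + χQR x
        ≡⟨ cong₂ _+_ (sum-cong-≗ (νs≡x⇔s≡t x≡νt)) (⟦no⟧ (isQR? x) (λ x∈R → proj₂ x∈N (proj₂ x∈R))) ⟩
      ∑[ s < p ] (δ s t * χQR s) + 0
        ≡⟨ +-identityʳ _ ⟩
      ∑[ s < p ] (δ s t * χQR s)
        ≡⟨ sum-δ′ t χQR ⟩
      χQR t
        ≡⟨ ⟦yes⟧ (isQR? t) t∈R ⟩
      1
        ∎
      where
      νs≡x⇔s≡t : ∀ {t} → x ≡ ν *F t → ∀ s → χQR s * δ (ν *F s) x ≡ δ s t * χQR s
      νs≡x⇔s≡t {t} x≡νt s = trans (*-comm (χQR s) _)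
        (cong (_* χQR s) (trans (cong (δ (ν *F s)) x≡νt) (δ-*F-cancel (proj₁ ν∈N) s t)))

  -- Expanding #differences = n δ₀ + χQR in both factors of diffCount-D.
  diffCount-D≡ : ∀ x → diffCount D x ≡ n * (n * δ 0F x + #νR x) + (n * χQR x + #R+νR x)
  diffCount-D≡ x = begin
    diffCount D x
      ≡⟨ trans (diffCount-D x) (pairSum-congʷ H #differences≡) ⟩
    pairSum (λ r → n * δ 0F r + χQR r) H
      ≡⟨ pairSum-point-mass n 0F χQR H ⟩
    n * (n * H 0F 0F + ∑[ s < p ] (χQR s * H 0F s)) + ∑[ r < p ] (χQR r * (n * H r 0F + K r))
      ≡⟨ cong₂ (λ a b → n * (n * a + b) + ∑[ r < p ] (χQR r * (n * H r 0F + K r))) (H-0 0F)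
                 (sum-cong-≗ (λ s → cong (χQR s *_) (H0- s))) ⟩
    n * (n * δ 0F x + #νR x) + ∑[ r < p ] (χQR r * (n * H r 0F + K r))
      ≡⟨ cong (n * (n * δ 0F x + #νR x) +_) (trans (sum-cong-≗ (λ r → *-distribˡ-+ (χQR r) _ _))
                            (∑-distrib-+ (λ r → χQR r * (n * H r 0F)) (λ r → χQR r * K r))) ⟩
    n * (n * δ 0F x + #νR x) + (∑[ r < p ] (χQR r * (n * H r 0F)) + #R+νR x)
      ≡⟨ cong (λ t → n * (n * δ 0F x + #νR x) + (t + #R+νR x)) ∑χQR*n*H-0≡n*χQR ⟩
    n * (n * δ 0F x + #νR x) + (n * χQR x + #R+νR x)
      ∎
    where
    open ≡-Reasoning
    H : F → F → ℕ
    H r s = δ (r +F ν *F s) x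
    K : F → ℕ
    K r = ∑[ s < p ] (χQR s * H r s)
    H-0 : ∀ r → H r 0F ≡ δ r x
    H-0 r = cong (λ t → δ t x) (trans (cong (r +F_) (*F-zeroʳ ν)) (+F-identityʳ r))
    H0- : ∀ s → H 0F s ≡ δ (ν *F s) x
    H0- s = cong (λ t → δ t x) (+F-identityˡ (ν *F s))
    ∑χQR*n*H-0≡n*χQR : ∑[ r < p ] (χQR r * (n * H r 0F)) ≡ n * χQR x
    ∑χQR*n*H-0≡n*χQR = begin
      ∑[ r < p ] (χQR r * (n * H r 0F))
        ≡⟨ sum-cong-≗ (λ r → trans (cong (λ t → χQR r * (n * t)) (H-0 r)) (reorder (χQR r) n (δ r x))) ⟩
      ∑[ r < p ] (n * (δ r x * χQR r))
        ≡⟨ *-distribˡ-sum n (λ r → δ r x * χQR r) ⟨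
      n * ∑[ r < p ] (δ r x * χQR r)
        ≡⟨ cong (n *_) (sum-δ′ x χQR) ⟩
      n * χQR x
        ∎
      where
      reorder : ∀ a b c → a * (b * c) ≡ b * (c * a)
      reorder = solve-∀

  diffCount-D≢0 : ∀ x → 0F ≢ x → diffCount D x ≡ n + γ
  diffCount-D≢0 x 0≢x = begin
    diffCount D x
      ≡⟨ diffCount-D≡ x ⟩
    n * (n * δ 0F x + #νR x) + (n * χQR x + #R+νR x)
      ≡⟨ cong₂ (λ d g → n * (n * d + #νR x) + (n * χQR x + g)) (δ-≢ 0≢x) (#R+νR-const x 0≢x) ⟩
    n * (n * 0 + #νR x) + (n * χQR x + γ)
      ≡⟨ rearrange n (#νR x) (χQR x) γ ⟩
    n * (#νR x + χQR x) + γ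
      ≡⟨ cong (λ t → n * t + γ) (#νR+χQR≡1 x 0≢x) ⟩
    n * 1 + γ
      ≡⟨ cong (_+ γ) (*-identityʳ n) ⟩
    n + γ
      ∎
    where
    open ≡-Reasoning
    rearrange : ∀ n a b g → n * (n * 0 + a) + (n * b + g) ≡ n * (a + b) + g
    rearrange = solve-∀

  n[n+1]/2≡n+γ : (n * (n + 1)) / 2 ≡ n + γ
  n[n+1]/2≡n+γ = trans (cong (_/ 2) n[n+1]≡[n+γ]*2) (m*n/n≡m (n + γ) 2)
    where
    open ≡-Reasoning
    n[n+1]≡[n+γ]*2 : n * (n + 1) ≡ (n + γ) * 2
    n[n+1]≡[n+γ]*2 = begin
      n * (n + 1)            ≡⟨ a[a+1]≡a*a+a n ⟩
      n * n + n              ≡⟨ cong (_+ n) (trans n*n≡n+R (cong (n +_) R≡γ+γ)) ⟩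
      n + (γ + γ) + n        ≡⟨ a+[b+b]+a≡[a+b]*2 n γ ⟩
      (n + γ) * 2            ∎
      where
      a[a+1]≡a*a+a : ∀ a → a * (a + 1) ≡ a * a + a
      a[a+1]≡a*a+a = solve-∀
      a+[b+b]+a≡[a+b]*2 : ∀ a b → a + (b + b) + a ≡ (a + b) * 2
      a+[b+b]+a≡[a+b]*2 = solve-∀

  isDifferenceSet : IsDifferenceSet p (n * n) ((n * (n + 1)) / 2) D
  isDifferenceSet = refl , ∣D∣≡n² , λ x x≢0 → trans (diffCount-D≢0 x (x≢0 ∘ sym)) (sym n[n+1]/2≡n+γ)

claim2p9 : (p : ℕ) (pr : Prime p) → let open Fp p pr in
    (A : Subset p) → DiffExactlyQR A → (ν : F) → IsQNR ν →
    (∀ a₁ b₁ a₂ b₂ → a₁ ∈ A → b₁ ∈ A → a₂ ∈ A → b₂ ∈ A →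
       a₁ +F ν *F b₁ ≡ a₂ +F ν *F b₂ → a₁ ≡ a₂ × b₁ ≡ b₂)
    × IsDifferenceSet p (∣ A ∣ * ∣ A ∣) ((∣ A ∣ * (∣ A ∣ + 1)) / 2) (sumSet A ν)
claim2p9 p pr A A-A≐R ν ν∈N = (λ _ _ _ _ → sum-injective) , isDifferenceSet
  where open SumSetConstruction p pr A ν A-A≐R ν∈N
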